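{- The following are logically equivalent: (1) (Rosolini choice) for all $P,Q:\mathcal U$, $\operatorname{isRosolini}(P)\to\big(P\to\lVert\operatorname{rosoliniStructure}(Q)\rVert\big)\to\big\lVert P\to\operatorname{rosoliniStructure}(Q)\big\rVert$; (2) the Rosolini propositions form a dominance, i.e. the family $\operatorname{isRosolini}:\mathcal U\to\mathcal U$ is a dominance.
   Context: Type theory: Martin-Löf type theory with universe $\mathcal U$, function extensionality, proposition extensionality and propositional truncations $\lVert X\rVert$. A proposition is a type any two of whose elements are equal. For $\alpha:\mathbb N\to 2$ let $\langle\alpha\rangle:=\sum_{n:\mathbb N}(\alpha_n=1)$. The extended naturals are $\mathbb N_\infty:=\sum_{\alpha:\mathbb N\to 2}\operatorname{isProp}(\langle\alpha\rangle)$ (binary sequences with at most one $1$), and $\langle u\rangle$ for $u:\mathbb N_\infty$ means $\langle\alpha\rangle$ for its underlying sequence. A Rosolini structure on $P:\mathcal U$ is an element of $\operatorname{rosoliniStructure}(P):=\sum_{u:\mathbb N_\infty}(P=\langle u\rangle)$, and $\operatorname{isRosolini}(P):=\lVert\operatorname{rosoliniStructure}(P)\rVert$. A dominance is a family $\operatorname{d}:\mathcal U\to\mathcal U$ such that $\operatorname{isProp}(\operatorname{d}(X))$ for all $X$, $\operatorname{d}(X)\to\operatorname{isProp}(X)$ for all $X$, $\operatorname{d}(1)$ holds, and for all $P,Q:\mathcal U$, $\operatorname{d}(P)\to(P\to\operatorname{d}(Q))\to\operatorname{d}(P\times Q)$. -}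

module Defs where

open import Level using (Level; Setω; _⊔_) renaming (suc to lsuc)
open import Data.Nat using (ℕ)
open import Data.Bool using (Bool; true)
open import Data.Unit using (⊤)
open import Data.Product using (Σ; _×_; proj₁)
open import Function.Bundles using (_⇔_)
open import Relation.Binary.PropositionalEquality using (_≡_)
open import Axiom.Extensionality.Propositional using (Extensionality)

isProp : ∀ {ℓ} → Set ℓ → Set ℓ
isProp X = (x y : X) → x ≡ y

record PropTrunc : Setω where
  field
    ∥_∥ : ∀ {ℓ} → Set ℓ → Set ℓ
    ∣_∣ : ∀ {ℓ} {X : Set ℓ} → X → ∥ X ∥
    ∥∥-isProp : ∀ {ℓ} {X : Set ℓ} → isProp ∥ X ∥
    ∥∥-rec : ∀ {ℓ ℓ'} {X : Set ℓ} {Y : Set ℓ'} → isProp Y → (X → Y) → ∥ X ∥ → Y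

FunExt : Setω
FunExt = ∀ {a b} → Extensionality a b

PropExt : Set₁
PropExt = {P Q : Set} → isProp P → isProp Q → (P → Q) → (Q → P) → P ≡ Q

-- ⟨α⟩ := Σ n, α n = 1   (2 = Bool, 1 = true)
⟨_⟩ₛ : (ℕ → Bool) → Set
⟨ α ⟩ₛ = Σ ℕ (λ n → α n ≡ true)

-- Extended naturals: sequences with at most one 1.
ℕ∞ : Set
ℕ∞ = Σ (ℕ → Bool) (λ α → isProp ⟨ α ⟩ₛ)

⟨_⟩ : ℕ∞ → Set
⟨ u ⟩ = ⟨ proj₁ u ⟩ₛ

rosoliniStructure : Set → Set₁
rosoliniStructure P = Σ ℕ∞ (λ u → P ≡ ⟨ u ⟩)

module _ (pt : PropTrunc) where
  open PropTrunc pt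

  isRosolini : Set → Set₁
  isRosolini P = ∥ rosoliniStructure P ∥

  RosoliniChoice : Set₁
  RosoliniChoice = (P Q : Set) → isRosolini P → (P → ∥ rosoliniStructure Q ∥)
                   → ∥ (P → rosoliniStructure Q) ∥

isDominance : ∀ {ℓ} → (Set → Set ℓ) → Set (lsuc Level.zero ⊔ ℓ)
isDominance d =
    ((X : Set) → isProp (d X))
  × ((X : Set) → d X → isProp X)
  × d ⊤
  × ((P Q : Set) → d P → (P → d Q) → d (P × Q))

-- A Rosolini proposition is ⟨u⟩ for some u : ℕ∞, and the sums Σ ⟨u⟩ (⟨_⟩ ∘ v) are again
-- of this form: interleave the sequences along a pairing ℕ ≅ ℕ × ℕ, so that the index
-- k = pair (n , m) is marked exactly when u marks n and v at n marks m.  Hence Rosolini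
-- propositions are closed under Σ as soon as the family P → rosoliniStructure Q can be
-- chosen from the merely given structures, which is Rosolini choice.  Conversely, if
-- P × Q is Rosolini then, for every p : P, the same structure serves Q ≡ P × Q.
module Submission where

open import Defs
open import Function.Bundles using (_⇔_; mk⇔)
open import Function using (_∘_)
open import Data.Nat using (ℕ; zero; suc; _+_)
open import Data.Nat.Properties using (+-suc; +-identityʳ; suc-injective)
open import Data.Bool using (Bool; true; false; _≟_)
open import Data.Unit using (⊤; tt)
open import Data.Product using (Σ; _×_; _,_; proj₁; proj₂)
open import Relation.Binary.PropositionalEquality
open import Axiom.UniquenessOfIdentityProofs using (module Constant⇒UIP; module Decidable⇒UIP)

isProp-Σ : ∀ {a b} {A : Set a} {B : A → Set b} →
           isProp A → (∀ x → isProp (B x)) → isProp (Σ A B)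
isProp-Σ A-isProp B-isProp (x , y) (x' , y') with A-isProp x x'
... | refl = cong (x ,_) (B-isProp x y y')

isProp⇒UIP : ∀ {a} {A : Set a} → isProp A → {x y : A} → isProp (x ≡ y)
isProp⇒UIP A-isProp =
  Constant⇒UIP.≡-irrelevant (λ {x} {y} _ → trans (sym (A-isProp x x)) (A-isProp x y))
                            (λ _ _ → refl)

isProp-isProp : FunExt → ∀ {a} {A : Set a} → isProp (isProp A)
isProp-isProp fe f g = fe λ x → fe λ y → isProp⇒UIP f (f x y) (g x y)

⟨⟩ₛ-isProp : {α : ℕ → Bool} → ((x y : ⟨ α ⟩ₛ) → proj₁ x ≡ proj₁ y) → isProp ⟨ α ⟩ₛ
⟨⟩ₛ-isProp same-index (k , t) (k' , t') with same-index (k , t) (k' , t')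
... | refl = cong (k ,_) (Decidable⇒UIP.≡-irrelevant _≟_ t t')

triangle : ℕ → ℕ
triangle zero    = zero
triangle (suc n) = triangle n + suc n

pair : ℕ × ℕ → ℕ
pair (a , b) = triangle (a + b) + b

step : ℕ × ℕ → ℕ × ℕ
step (zero  , b) = (suc b , zero)
step (suc a , b) = (a , suc b)

unpair : ℕ → ℕ × ℕ
unpair zero    = (zero , zero)
unpair (suc k) = step (unpair k)

pair-step : ∀ p → pair (step p) ≡ suc (pair p)
pair-step (zero , b) = begin
  triangle (suc b + 0) + 0 ≡⟨ +-identityʳ _ ⟩
  triangle (suc b + 0)     ≡⟨ cong triangle (+-identityʳ (suc b)) ⟩
  triangle b + suc b       ≡⟨ +-suc (triangle b) b ⟩
  suc (triangle b + b)     ∎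
  where open ≡-Reasoning
pair-step (suc a , b) = begin
  triangle (a + suc b) + suc b ≡⟨ cong (λ n → triangle n + suc b) (+-suc a b) ⟩
  triangle (suc a + b) + suc b ≡⟨ +-suc _ b ⟩
  suc (triangle (suc a + b) + b) ∎
  where open ≡-Reasoning

pair-unpair : ∀ k → pair (unpair k) ≡ k
pair-unpair zero    = refl
pair-unpair (suc k) = trans (pair-step (unpair k)) (cong suc (pair-unpair k))

mutual
  unpair-pair : ∀ k p → pair p ≡ k → unpair k ≡ p
  unpair-pair k (zero  , zero)  refl = refl
  unpair-pair k (a     , suc b) e    = unpair-pair-step k (suc a , b) e
  unpair-pair k (suc a , zero)  e    = unpair-pair-step k (zero , a) e

  unpair-pair-step : ∀ k p → pair (step p) ≡ k → unpair k ≡ step p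
  unpair-pair-step zero    p e with () ← trans (sym (pair-step p)) e
  unpair-pair-step (suc k) p e =
    cong step (unpair-pair k p (suc-injective (trans (sym (pair-step p)) e)))

_∧ᵈ_ : (b : Bool) → (b ≡ true → Bool) → Bool
true  ∧ᵈ c = c refl
false ∧ᵈ c = false

∧ᵈ-true⁻ : ∀ b (c : b ≡ true → Bool) → (b ∧ᵈ c) ≡ true → Σ (b ≡ true) λ e → c e ≡ true
∧ᵈ-true⁻ true c t = refl , t

∧ᵈ-true⁺ : ∀ {b} (c : b ≡ true → Bool) (e : b ≡ true) → c e ≡ true → (b ∧ᵈ c) ≡ true
∧ᵈ-true⁺ c refl t = t

module Σℕ∞ (u : ℕ∞) (v : ⟨ u ⟩ → ℕ∞) where

  entry : ℕ × ℕ → Bool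
  entry (n , m) = proj₁ u n ∧ᵈ λ e → proj₁ (v (n , e)) m

  sequence : ℕ → Bool
  sequence = entry ∘ unpair

  split : ⟨ sequence ⟩ₛ → Σ ⟨ u ⟩ (⟨_⟩ ∘ v)
  split (k , t) with ∧ᵈ-true⁻ _ _ t
  ... | e , t' = (proj₁ (unpair k) , e) , (proj₂ (unpair k) , t')

  merge : Σ ⟨ u ⟩ (⟨_⟩ ∘ v) → ⟨ sequence ⟩ₛ
  merge ((n , e) , (m , t)) =
    pair (n , m) , subst (λ p → entry p ≡ true) (sym (unpair-pair _ (n , m) refl))
                         (∧ᵈ-true⁺ _ e t)

  sum-isProp : isProp (Σ ⟨ u ⟩ (⟨_⟩ ∘ v))
  sum-isProp = isProp-Σ (proj₂ u) (proj₂ ∘ v)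

  index : Σ ⟨ u ⟩ (⟨_⟩ ∘ v) → ℕ
  index ((n , _) , (m , _)) = pair (n , m)

  sequence-isProp : isProp ⟨ sequence ⟩ₛ
  sequence-isProp = ⟨⟩ₛ-isProp λ x y → begin
    proj₁ x         ≡⟨ sym (pair-unpair (proj₁ x)) ⟩
    index (split x) ≡⟨ cong index (sum-isProp (split x) (split y)) ⟩
    index (split y) ≡⟨ pair-unpair (proj₁ y) ⟩
    proj₁ y         ∎
    where open ≡-Reasoning

Σℕ∞ : (u : ℕ∞) → (⟨ u ⟩ → ℕ∞) → ℕ∞
Σℕ∞ u v = Σℕ∞.sequence u v , Σℕ∞.sequence-isProp u v

⟨Σℕ∞⟩≡Σ : PropExt → (u : ℕ∞) (v : ⟨ u ⟩ → ℕ∞) → ⟨ Σℕ∞ u v ⟩ ≡ Σ ⟨ u ⟩ (⟨_⟩ ∘ v)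
⟨Σℕ∞⟩≡Σ pe u v = pe sequence-isProp sum-isProp split merge
  where open Σℕ∞ u v

isZero : ℕ → Bool
isZero zero    = true
isZero (suc _) = false

ℕ∞-one : ℕ∞
ℕ∞-one = isZero , ⟨⟩ₛ-isProp only-zero
  where
  only-zero : (x y : ⟨ isZero ⟩ₛ) → proj₁ x ≡ proj₁ y
  only-zero (zero  , _)  (zero  , _)  = refl
  only-zero (suc _ , ()) _
  only-zero _            (suc _ , ())

rosoliniStructure→isProp : ∀ {P} → rosoliniStructure P → isProp P
rosoliniStructure→isProp (u , refl) = proj₂ u

rosoliniStructure-⊤ : PropExt → rosoliniStructure ⊤
rosoliniStructure-⊤ pe = ℕ∞-one , pe (λ _ _ → refl) (proj₂ ℕ∞-one) (λ _ → zero , refl) (λ _ → tt)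

rosoliniStructure-Σ : FunExt → PropExt → {P : Set} {Q : P → Set} →
                      rosoliniStructure P → ((p : P) → rosoliniStructure (Q p)) →
                      rosoliniStructure (Σ P Q)
rosoliniStructure-Σ fe pe (u , refl) sQ =
  Σℕ∞ u v , trans (cong (Σ ⟨ u ⟩) (fe (proj₂ ∘ sQ))) (sym (⟨Σℕ∞⟩≡Σ pe u v))
  where
  v : ⟨ u ⟩ → ℕ∞
  v = proj₁ ∘ sQ

rosoliniStructure-projʳ : PropExt → {P Q : Set} → P →
                          rosoliniStructure (P × Q) → rosoliniStructure Q
rosoliniStructure-projʳ pe {P} {Q} p (u , e) = u , trans (pe Q-isProp P×Q-isProp (p ,_) proj₂) e
  where
  P×Q-isProp : isProp (P × Q)
  P×Q-isProp = rosoliniStructure→isProp (u , e)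
  Q-isProp : isProp Q
  Q-isProp q q' = cong proj₂ (P×Q-isProp (p , q) (p , q'))

module _ (pt : PropTrunc) (fe : FunExt) (pe : PropExt) where
  open PropTrunc pt

  ∥∥-map : ∀ {a b} {A : Set a} {B : Set b} → (A → B) → ∥ A ∥ → ∥ B ∥
  ∥∥-map f = ∥∥-rec ∥∥-isProp (∣_∣ ∘ f)

  ∥∥-map₂ : ∀ {a b c} {A : Set a} {B : Set b} {C : Set c} →
            (A → B → C) → ∥ A ∥ → ∥ B ∥ → ∥ C ∥
  ∥∥-map₂ f x y = ∥∥-rec ∥∥-isProp (λ a → ∥∥-map (f a) y) x

  isRosolini→isProp : ∀ {P} → isRosolini pt P → isProp P
  isRosolini→isProp = ∥∥-rec (isProp-isProp fe) rosoliniStructure→isProp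

  RosoliniChoice→isDominance : RosoliniChoice pt → isDominance (isRosolini pt)
  RosoliniChoice→isDominance choice =
      (λ _ → ∥∥-isProp)
    , (λ _ → isRosolini→isProp)
    , ∣ rosoliniStructure-⊤ pe ∣
    , λ P Q rP rQ → ∥∥-map₂ (rosoliniStructure-Σ fe pe) rP (choice P Q rP rQ)

  isDominance→RosoliniChoice : isDominance (isRosolini pt) → RosoliniChoice pt
  isDominance→RosoliniChoice (_ , _ , _ , closed-×) P Q rP rQ =
    ∥∥-map (λ s p → rosoliniStructure-projʳ pe p s) (closed-× P Q rP rQ)

theorem5p30 : (pt : PropTrunc) → FunExt → PropExt →
    RosoliniChoice pt ⇔ isDominance (isRosolini pt)
theorem5p30 pt fe pe =
  mk⇔ (RosoliniChoice→isDominance pt fe pe) (isDominance→RosoliniChoice pt fe pe)
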